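{- The functors $G:\mathrm{CPM}(\mathbf{Rel})\to\mathcal{G}$ and $C:\mathcal{G}\to\mathrm{CPM}(\mathbf{Rel})$ are inverse to each other; in particular $\mathrm{CPM}(\mathbf{Rel})$ and $\mathcal{G}$ are isomorphic categories.
   Context: $\mathbf{Rel}$: sets and binary relations, dagger the converse relation; a relation $P: X\to X$ is positive if $P=T^\dagger\circ T$ for some relation $T: X\to Y$. $\mathrm{CPM}(\mathbf{Rel})$ has sets as objects; a morphism $A\to B$ is a relation $R\subseteq(A\times A)\times(B\times B)$ such that the relation $\overline{R}$ on $A\times B$, $\overline{R}((a_1,b_1),(a_2,b_2))\iff R(a_2,a_1,b_2,b_1)$, is positive; composition is $(S\circ R)(a,a',c,c')\iff\exists b,b'.\ R(a,a',b,b')\wedge S(b,b',c,c')$, identity $1_A(a_1,a_2,a_3,a_4)\iff a_1=a_3\wedge a_2=a_4$. A graph is a vertex set $W$ with a set $E$ of unordered pairs $\{v,w\}$ of vertices ($v=w$ allowed) such that $\{v\}\in E$ for every $v\in W$; write $V(\gamma),E(\gamma)$. The category $\mathcal{G}$ has sets as objects; a morphism $\gamma: A\to B$ is a graph whose vertex set is a subset of $A\times B$; composition: $V(\gamma'\circ\gamma)=\{(a,c)\mid\exists b.\ (a,b)\in V(\gamma)\wedge(b,c)\in V(\gamma')\}$, $E(\gamma'\circ\gamma)=\{\{(a,c),(a',c')\}\mid\exists b,b'.\ \{(a,b),(a',b')\}\in E(\gamma)\wedge\{(b,c),(b',c')\}\in E(\gamma')\}$; identity $1_A$ is the complete graph on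 $\{(a,a)\mid a\in A\}$. The functor $G$ is the identity on objects and sends $R: A\to B$ to the graph with vertices $\{(a,b)\mid R(a,a,b,b)\}$ and edges $\{\{(a,b),(a',b')\}\mid R(a,a',b,b')\}$. The functor $C$ is the identity on objects and sends a graph $\gamma: A\to B$ to the relation $C(\gamma)(a,a',b,b')\iff\{(a,b),(a',b')\}\in E(\gamma)$. -}

module Defs where

open import Data.Product using (Σ; ∃; _×_; _,_)
open import Relation.Binary.PropositionalEquality using (_≡_)
open import Function.Bundles using (_⇔_)

-- Rel: sets are types in Set, relations are Set-valued predicates.

BinRel : Set → Set → Set₁
BinRel X Y = X → Y → Set

_† : {X Y : Set} → BinRel X Y → BinRel Y X
(R †) y x = R x y

_∘ᴿ_ : {X Y Z : Set} → BinRel Y Z → BinRel X Y → BinRel X Z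
(S ∘ᴿ T) x z = ∃ λ y → T x y × S y z

_≐_ : {X Y : Set} → BinRel X Y → BinRel X Y → Set
R ≐ R' = ∀ x y → R x y ⇔ R' x y

Positive : {X : Set} → BinRel X X → Set₁
Positive {X} P = Σ Set λ Y → Σ (BinRel X Y) λ T → P ≐ ((T †) ∘ᴿ T)

-- a relation R ⊆ (A × A) × (B × B), written R a a' b b'
Rel4 : Set → Set → Set₁
Rel4 A B = A → A → B → B → Set

bar : {A B : Set} → Rel4 A B → BinRel (A × B) (A × B)
bar R (a₁ , b₁) (a₂ , b₂) = R a₂ a₁ b₂ b₁

IsCPM : {A B : Set} → Rel4 A B → Set₁
IsCPM R = Positive (bar R)

_∘ᶜ_ : {A B C : Set} → Rel4 B C → Rel4 A B → Rel4 A C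
(S ∘ᶜ R) a a' c c' = ∃ λ b → ∃ λ b' → R a a' b b' × S b b' c c'

idᶜ : (A : Set) → Rel4 A A
idᶜ A a₁ a₂ a₃ a₄ = (a₁ ≡ a₃) × (a₂ ≡ a₄)

_≈ᶜ_ : {A B : Set} → Rel4 A B → Rel4 A B → Set
R ≈ᶜ R' = ∀ a a' b b' → R a a' b b' ⇔ R' a a' b b'

-- The category 𝒢.  A set of unordered pairs {v,w} of elements of A × B is
-- encoded as a symmetric binary predicate E (E v w means {v,w} ∈ E).

record RawGraph (A B : Set) : Set₁ where
  field
    V : A × B → Set
    E : A × B → A × B → Set
open RawGraph public

record IsGraph {A B : Set} (γ : RawGraph A B) : Set where
  field
    E-sym   : ∀ v w → E γ v w → E γ w v
    E-vert  : ∀ v w → E γ v w → V γ v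
    E-loop  : ∀ v → V γ v → E γ v v

_∘ᵍ_ : {A B C : Set} → RawGraph B C → RawGraph A B → RawGraph A C
V (γ' ∘ᵍ γ) (a , c) = ∃ λ b → V γ (a , b) × V γ' (b , c)
E (γ' ∘ᵍ γ) (a , c) (a' , c') =
  ∃ λ b → ∃ λ b' → E γ (a , b) (a' , b') × E γ' (b , c) (b' , c')

idᵍ : (A : Set) → RawGraph A A
V (idᵍ A) (a , a') = a ≡ a'
E (idᵍ A) (a₁ , a₂) (a₃ , a₄) = (a₁ ≡ a₂) × (a₃ ≡ a₄)

_≈ᵍ_ : {A B : Set} → RawGraph A B → RawGraph A B → Set
γ ≈ᵍ γ' = (∀ v → V γ v ⇔ V γ' v) × (∀ v w → E γ v w ⇔ E γ' v w)

-- The functors G and C (on morphisms; both are the identity on objects).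

G : {A B : Set} → Rel4 A B → RawGraph A B
V (G R) (a , b) = R a a b b
E (G R) (a , b) (a' , b') = R a a' b b'

C : {A B : Set} → RawGraph A B → Rel4 A B
C γ a a' b b' = E γ (a , b) (a' , b')

module Submission where

-- The isomorphism CPM(Rel) ≅ 𝒢 rests on one characterisation of positivity
-- in Rel:  a relation P on X is positive (P = T† ∘ T) exactly when it is
-- symmetric and "reflexive on its support" (P x y implies P y y).
--   * If P = T† ∘ T then P x y means that x and y share a T-image z, which
--     is symmetric and also witnesses P y y.
--   * Conversely, for such P take T to relate x to every P-related pair
--     (v , w) having x as an endpoint; sharing an image then recovers P.
-- Unfolding bar, a CPM morphism R is thus a 4-ary relation that is symmetric
-- (R a a' b b' → R a' a b' b) and whose related pairs have loops
-- (R a a' b b' → R a a b b): these are precisely the edge relations of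
-- graphs.  So G R is a graph, C γ is a CPM morphism, and C (G R) = R and
-- G (C γ) = γ hold on edges by definition, while on vertices they use that
-- vertices of a graph are exactly its loops.  Functoriality is definitional
-- on edges; on vertices of a composite, the loop property lets a path
-- a , b , b' , c through distinct middle points be replaced by one through b.

open import Defs
open import Data.Product using (_×_; _,_; proj₁; proj₂)
open import Data.Sum using (_⊎_; inj₁; inj₂)
open import Function.Bundles using (_⇔_; mk⇔; module Equivalence)
open import Function.Construct.Identity using (⇔-id)
open import Relation.Binary.PropositionalEquality using (_≡_; refl)

Symmetric : {X : Set} → BinRel X X → Set
Symmetric P = ∀ x y → P x y → P y x

LoopClosed : {X : Set} → BinRel X X → Set
LoopClosed P = ∀ x y → P x y → P y y

module _ {X : Set} {P : BinRel X X} (pos : Positive P) where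
  private
    T = proj₁ (proj₂ pos)

    shared-image : ∀ x y → P x y ⇔ ((T †) ∘ᴿ T) x y
    shared-image = proj₂ (proj₂ pos)

  positive-sym : Symmetric P
  positive-sym x y p with Equivalence.to (shared-image x y) p
  ... | z , tx , ty = Equivalence.from (shared-image y x) (z , ty , tx)

  positive-loop : LoopClosed P
  positive-loop x y p with Equivalence.to (shared-image x y) p
  ... | z , _ , ty = Equivalence.from (shared-image y y) (z , ty , ty)

-- Conversely, a symmetric loop-closed relation is positive: factor it
-- through its set of related pairs, each pair incident to its two endpoints.
module _ {X : Set} {P : BinRel X X} (sym : Symmetric P) (loop : LoopClosed P) where
  Incidence : BinRel X (X × X)
  Incidence x (v , w) = P v w × (x ≡ v ⊎ x ≡ w)

  private
    shared-pair : ∀ x y → P x y → ((Incidence †) ∘ᴿ Incidence) x y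
    shared-pair x y p = (x , y) , (p , inj₁ refl) , (p , inj₂ refl)

    ends-related : ∀ x y → ((Incidence †) ∘ᴿ Incidence) x y → P x y
    ends-related _ _ ((v , w) , (p , inj₁ refl) , (_ , inj₁ refl)) = loop w v (sym v w p)
    ends-related _ _ ((v , w) , (p , inj₁ refl) , (_ , inj₂ refl)) = p
    ends-related _ _ ((v , w) , (p , inj₂ refl) , (_ , inj₁ refl)) = sym v w p
    ends-related _ _ ((v , w) , (p , inj₂ refl) , (_ , inj₂ refl)) = loop v w p

  symmetric-loopClosed⇒positive : Positive P
  symmetric-loopClosed⇒positive =
    (X × X) , Incidence , λ x y → mk⇔ (shared-pair x y) (ends-related x y)

module _ {A B : Set} {R : Rel4 A B} (cpm : IsCPM R) where
  cpm-sym : ∀ a a' b b' → R a a' b b' → R a' a b' b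
  cpm-sym a a' b b' = positive-sym cpm (a' , b') (a , b)

  cpm-loop : ∀ a a' b b' → R a a' b b' → R a a b b
  cpm-loop a a' b b' = positive-loop cpm (a' , b') (a , b)

module _ {A B : Set} {γ : RawGraph A B} (graph : IsGraph γ) where
  open IsGraph graph

  edge-loop : ∀ v w → E γ v w → E γ v v
  edge-loop v w e = E-loop v (E-vert v w e)

  vertex⇔loop : ∀ v → E γ v v ⇔ V γ v
  vertex⇔loop v = mk⇔ (E-vert v v) (E-loop v)

G-graph : {A B : Set} (R : Rel4 A B) → IsCPM R → IsGraph (G R)
G-graph R cpm = record
  { E-sym  = λ (a , b) (a' , b') → cpm-sym cpm a a' b b'
  ; E-vert = λ (a , b) (a' , b') → cpm-loop cpm a a' b b'
  ; E-loop = λ _ loop → loop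
  }

-- C sends graphs to CPM morphisms: bar (C γ) is the converse of E γ,
-- which is symmetric and loop-closed because E γ is.
C-cpm : {A B : Set} (γ : RawGraph A B) → IsGraph γ → IsCPM (C γ)
C-cpm γ graph = symmetric-loopClosed⇒positive
  (λ v w → IsGraph.E-sym graph w v)
  (λ v w → edge-loop graph w v)

-- Edges agree by definition; a vertex of G (S ∘ᶜ R)
-- is a path a , (b , b') , c, and the loop property of R and S shortens it
-- to a path through the single middle vertex b.
G-∘ : {A B D : Set} (R : Rel4 A B) (S : Rel4 B D) → IsCPM R → IsCPM S →
      G (S ∘ᶜ R) ≈ᵍ (G S ∘ᵍ G R)
G-∘ R S cpmR cpmS = vertices , λ _ _ → ⇔-id _
  where
  vertices : ∀ v → V (G (S ∘ᶜ R)) v ⇔ V (G S ∘ᵍ G R) v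
  vertices (a , c) = mk⇔
    (λ (b , b' , r , s) → b , cpm-loop cpmR a a b b' r , cpm-loop cpmS b b' c c s)
    (λ (b , r , s) → b , b , r , s)

G-id : (A : Set) → G (idᶜ A) ≈ᵍ idᵍ A
G-id A = (λ _ → mk⇔ proj₁ (λ e → e , e)) , λ _ _ → ⇔-id _

C-∘ : {A B D : Set} (γ : RawGraph A B) (δ : RawGraph B D) →
      C (δ ∘ᵍ γ) ≈ᶜ (C δ ∘ᶜ C γ)
C-∘ γ δ _ _ _ _ = ⇔-id _

C-id : (A : Set) → C (idᵍ A) ≈ᶜ idᶜ A
C-id A _ _ _ _ = ⇔-id _

C∘G : {A B : Set} (R : Rel4 A B) → C (G R) ≈ᶜ R
C∘G R _ _ _ _ = ⇔-id _

G∘C : {A B : Set} (γ : RawGraph A B) → IsGraph γ → G (C γ) ≈ᵍ γ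
G∘C γ graph = vertex⇔loop graph , λ _ _ → ⇔-id _

theorem4p12 :
    ((A B : Set) (R : Rel4 A B) → IsCPM R → IsGraph (G R))
    × ((A B D : Set) (R : Rel4 A B) (S : Rel4 B D) → IsCPM R → IsCPM S →
         G (S ∘ᶜ R) ≈ᵍ (G S ∘ᵍ G R))
    × ((A : Set) → G (idᶜ A) ≈ᵍ idᵍ A)
    × ((A B : Set) (γ : RawGraph A B) → IsGraph γ → IsCPM (C γ))
    × ((A B D : Set) (γ : RawGraph A B) (δ : RawGraph B D) → IsGraph γ → IsGraph δ →
         C (δ ∘ᵍ γ) ≈ᶜ (C δ ∘ᶜ C γ))
    × ((A : Set) → C (idᵍ A) ≈ᶜ idᶜ A)
    × ((A B : Set) (R : Rel4 A B) → IsCPM R → C (G R) ≈ᶜ R)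
    × ((A B : Set) (γ : RawGraph A B) → IsGraph γ → G (C γ) ≈ᵍ γ)
theorem4p12 =
    (λ _ _ → G-graph)
  , (λ _ _ _ → G-∘)
  , G-id
  , (λ _ _ → C-cpm)
  , (λ _ _ _ γ δ _ _ → C-∘ γ δ)
  , C-id
  , (λ _ _ R _ → C∘G R)
  , (λ _ _ → G∘C)
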